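{- Let $A$ be the set of $m\in\Omega$ for which the triple $(m,S(m),S^2(m))$ has permutation pattern $(1,2,3)$, $(1,3,2)$, or $(2,3,1)$, and let $B$ be the set of $m\in\Omega$ for which this triple has permutation pattern $(2,1,3)$, $(3,1,2)$, or $(3,2,1)$. Then $A$ has density $1/2$ and $B$ has density $1/2$, i.e. $\lim_{M\to\infty}\#\{a\in A:a\le M\}/(M/2)=\tfrac12$ and likewise for $B$.
   Context: Let $\Omega$ be the set of odd positive integers. The Syracuse function $S:\Omega\to\Omega$ is defined by $S(m)=(3m+1)/2^e$, where $e$ is the largest integer with $2^e\mid 3m+1$. For an $n$-tuple $X=(x_1,\dots,x_n)$ of distinct reals with coordinates in increasing order $y_1<\dots<y_n$, the permutation pattern of $X$ is the unique permutation $\sigma$ of $\{1,\dots,n\}$ with $x_i=y_{\sigma(i)}$, written $(\sigma(1),\dots,\sigma(n))$. -}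

module Defs where

open import Data.Nat using (ℕ; _+_; _*_; _<_; _≤_; NonZero)
open import Data.Nat.DivMod using (_%_; _/_)
open import Data.Nat.Properties using (_≟_; _<?_)
open import Data.Fin using (Fin; zero; suc) renaming (_<_ to _<ᶠ_; _<?_ to _<ᶠ?_)
open import Data.Fin.Properties using (all?) renaming (_≟_ to _≟ᶠ_)
open import Data.Vec.Functional using (Vector; []; _∷_)
open import Data.Product using (_×_; ∃; Σ)
open import Data.Sum using (_⊎_)
open import Data.List using (List; length; filter; upTo)
open import Relation.Binary.PropositionalEquality using (_≡_)
open import Relation.Nullary using (Dec; yes; no)
open import Relation.Nullary.Decidable using (_×-dec_; _→-dec_; _⊎-dec_)
open import Relation.Unary using (Pred; Decidable)
open import Data.Rational using (ℚ; ½; ∣_∣; _-_; 0ℚ) renaming (_<_ to _<ℚ_; _/_ to _÷_)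
open import Data.Integer using (+_)
open import Level using (0ℓ)

-- Ω : odd positive integers, as a predicate on ℕ
Odd : ℕ → Set
Odd m = m % 2 ≡ 1

Odd? : Decidable Odd
Odd? m = (m % 2) ≟ 1

-- divide out all factors of 2 (fuel-bounded; fuel n suffices for input n)
oddPart′ : ℕ → ℕ → ℕ
oddPart′ ℕ.zero n = n
oddPart′ (ℕ.suc f) ℕ.zero = ℕ.zero
oddPart′ (ℕ.suc f) (ℕ.suc n) with (ℕ.suc n) % 2 ≟ 0
... | yes _ = oddPart′ f (ℕ.suc n / 2)
... | no  _ = ℕ.suc n

oddPart : ℕ → ℕ
oddPart n = oddPart′ n n

S : ℕ → ℕ
S m = oddPart (3 * m + 1)

-- permutation pattern: x has pattern σ iff the coordinates of x are distinct
-- and x i < x j ⇔ σ i < σ j (equivalently x i = y (σ i) with y the sorted coords)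
HasPattern : ∀ {n} → Vector ℕ n → Vector (Fin n) n → Set
HasPattern {n} x σ =
  (∀ i j → x i ≡ x j → i ≡ j) ×
  (∀ i j → (x i < x j → σ i <ᶠ σ j) × (σ i <ᶠ σ j → x i < x j))

HasPattern? : ∀ {n} (x : Vector ℕ n) (σ : Vector (Fin n) n) → Dec (HasPattern x σ)
HasPattern? x σ =
  all? (λ i → all? (λ j → (x i ≟ x j) →-dec (i ≟ᶠ j)))
  ×-dec
  all? (λ i → all? (λ j → ((x i <? x j) →-dec (σ i <ᶠ? σ j)) ×-dec ((σ i <ᶠ? σ j) →-dec (x i <? x j))))

-- permutation (a,b,c) in one-line notation, with 1-based entries written as Fin 3
perm : Fin 3 → Fin 3 → Fin 3 → Vector (Fin 3) 3
perm a b c = a ∷ b ∷ c ∷ []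

f0 f1 f2 : Fin 3
f0 = zero
f1 = suc zero
f2 = suc (suc zero)

triple : ℕ → Vector ℕ 3
triple m = m ∷ S m ∷ S (S m) ∷ []

-- Fin 3 values 0,1,2 stand for pattern entries 1,2,3
InA : Pred ℕ 0ℓ
InA m = Odd m × (HasPattern (triple m) (perm f0 f1 f2)
               ⊎ HasPattern (triple m) (perm f0 f2 f1)
               ⊎ HasPattern (triple m) (perm f1 f2 f0))

InB : Pred ℕ 0ℓ
InB m = Odd m × (HasPattern (triple m) (perm f1 f0 f2)
               ⊎ HasPattern (triple m) (perm f2 f0 f1)
               ⊎ HasPattern (triple m) (perm f2 f1 f0))

InA? : Decidable InA
InA? m = Odd? m ×-dec (HasPattern? _ _ ⊎-dec HasPattern? _ _ ⊎-dec HasPattern? _ _)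

InB? : Decidable InB
InB? m = Odd? m ×-dec (HasPattern? _ _ ⊎-dec HasPattern? _ _ ⊎-dec HasPattern? _ _)

-- #{ a ∈ P : a ≤ M }  (upTo (ℕ.suc M) = [0 … M])
count : ∀ {P : Pred ℕ 0ℓ} → Decidable P → ℕ → ℕ
count P? M = length (filter P? (upTo (ℕ.suc M)))

-- lim_{M→∞} #{a ∈ P : a ≤ M} / (M/2) = δ  (ε–N definition over ℚ; M ranges over M ≥ 1
-- written as suc M, where #/(M/2) = 2·#/M)
HasOddDensity : ∀ {P : Pred ℕ 0ℓ} → Decidable P → ℚ → Set
HasOddDensity P? δ =
  ∀ (ε : ℚ) → 0ℚ <ℚ ε → ∃ λ N → ∀ M → N ≤ M →
    ∣ (+ (2 * count P? (ℕ.suc M)) ÷ ℕ.suc M) - δ ∣ <ℚ ε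

-- For odd m the sign of S m − m is decided by m mod 4: S(3 + 4k) = 5 + 6k > 3 + 4k, while
-- S(1 + 4k) ≤ 1 + 3k < 1 + 4k for k ≥ 1.  Besides 1, S has no fixed point (m·2^e = 3m + 1 forces
-- m = 1) and no 2-cycle, so (m, S m, S² m) has distinct entries unless S m = 1.  Hence A is exactly
-- the residue class 3 mod 4, and B is the class 1 mod 4 minus the m with 3m + 1 a power of 2, of
-- which there are only logarithmically many; each class has density 1/2 among the odd numbers.
module Submission where

open import Defs
open import Data.Product using (_×_)
open import Data.Rational using (½)

open import Data.Empty using (⊥-elim)
open import Data.Fin using (Fin; zero; suc) renaming (_<_ to _<ᶠ_)
open import Data.Fin.Properties using (all?) renaming (_≟_ to _≟ᶠ_; <-cmp to <ᶠ-cmp)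
open import Data.Integer as ℤ using (-[1+_]; _⊖_; +<+)
import Data.Integer.Properties as ℤ
open import Data.List using (length; filter; upTo; _++_; [_])
open import Data.List.Properties using (upTo-∷ʳ; filter-++; length-++)
open import Data.Nat using (ℕ; zero; suc; _+_; _*_; _^_; _∸_; _≤_; _<_; z≤n; s≤s; pred; ∣_-_∣)
open import Data.Nat.Coprimality using (Coprime)
open import Data.Nat.DivMod
open import Data.Nat.Divisibility using (m%n≡0⇒n∣m)
open import Data.Nat.Properties
open import Algebra.Properties.CommutativeSemigroup +-commutativeSemigroup using (interchange)
open import Data.Nat.Tactic.RingSolver using (solve-∀)
open import Data.Product using (∃; _,_; proj₁; proj₂; uncurry)
open import Data.Rational as ℚ using (mkℚ; _-_; toℚᵘ; *<*) renaming (_<_ to _<ℚ_; _/_ to _÷_)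
import Data.Rational.Properties as ℚ
open import Data.Rational.Unnormalised as ℚᵘ using (mkℚᵘ)
import Data.Rational.Unnormalised.Properties as ℚᵘ
open import Data.Sum using (_⊎_; inj₁; inj₂)
open import Data.Vec.Functional using (Vector; []; _∷_)
open import Function using (_∘_; _∘′_)
open import Level using (0ℓ)
open import Relation.Binary using (tri<; tri≈; tri>)
open import Relation.Binary.PropositionalEquality hiding ([_])
open import Relation.Nullary using (¬_; Dec; yes; no; contradiction)
open import Relation.Nullary.Decidable using (True; toWitness; _→-dec_)
open import Relation.Unary using (Pred; Decidable)

-- Permutation patterns

StrictlyIncreasing : ∀ {n} → Vector ℕ n → Set
StrictlyIncreasing y = ∀ {i j} → i <ᶠ j → y i < y j

IsInjective : ∀ {n} → Vector (Fin n) n → Set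
IsInjective σ = ∀ i j → σ i ≡ σ j → i ≡ j

isInjective? : ∀ {n} (σ : Vector (Fin n) n) → Dec (IsInjective σ)
isInjective? σ = all? λ i → all? λ j → (σ i ≟ᶠ σ j) →-dec (i ≟ᶠ j)

strictlyIncreasing-injective : ∀ {n} {y : Vector ℕ n} → StrictlyIncreasing y →
                               ∀ {i j} → y i ≡ y j → i ≡ j
strictlyIncreasing-injective {y = y} y↑ {i} {j} yi≡yj with <ᶠ-cmp i j
... | tri< i<j _ _ = contradiction yi≡yj (<⇒≢ (y↑ i<j))
... | tri≈ _ i≡j _ = i≡j
... | tri> _ _ j<i = contradiction (sym yi≡yj) (<⇒≢ (y↑ j<i))

-- The paper's definition: x has pattern σ when x i = y (σ i) for the sorted coordinates y.
HasPattern-sorted : ∀ {n} {y : Vector ℕ n} {σ : Vector (Fin n) n} →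
                    StrictlyIncreasing y → IsInjective σ → HasPattern (y ∘ σ) σ
HasPattern-sorted {y = y} {σ} y↑ σ-inj =
  (λ i j e → σ-inj i j (strictlyIncreasing-injective y↑ e)) , λ i j → reflect i j , y↑
  where
  reflect : ∀ i j → y (σ i) < y (σ j) → σ i <ᶠ σ j
  reflect i j lt with <ᶠ-cmp (σ i) (σ j)
  ... | tri< σi<σj _ _ = σi<σj
  ... | tri≈ _ σi≡σj _ = contradiction (cong y σi≡σj) (<⇒≢ lt)
  ... | tri> _ _ σj<σi = contradiction lt (<-asym (y↑ σj<σi))

HasPattern-resp-≗ : ∀ {n} {x x′ : Vector ℕ n} {σ : Vector (Fin n) n} →
                    x ≗ x′ → HasPattern x σ → HasPattern x′ σ
HasPattern-resp-≗ x≗x′ (inj , ord) =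
  (λ i j e → inj i j (trans (x≗x′ i) (trans e (sym (x≗x′ j))))) ,
  λ i j → (λ lt → proj₁ (ord i j) (subst₂ _<_ (sym (x≗x′ i)) (sym (x≗x′ j)) lt)) ,
          (λ s → subst₂ _<_ (x≗x′ i) (x≗x′ j) (proj₂ (ord i j) s))

increasing₃ : ∀ {a b c} → a < b → b < c → StrictlyIncreasing (a ∷ b ∷ c ∷ [])
increasing₃ a<b b<c {zero}           {suc zero}       _ = a<b
increasing₃ a<b b<c {zero}           {suc (suc zero)} _ = <-trans a<b b<c
increasing₃ a<b b<c {suc zero}       {suc (suc zero)} _ = b<c
increasing₃ a<b b<c {zero}           {zero}           ()
increasing₃ a<b b<c {suc zero}       {zero}           ()
increasing₃ a<b b<c {suc zero}       {suc zero}       (s≤s ())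
increasing₃ a<b b<c {suc (suc zero)} {zero}           ()
increasing₃ a<b b<c {suc (suc zero)} {suc zero}       (s≤s ())
increasing₃ a<b b<c {suc (suc zero)} {suc (suc zero)} (s≤s (s≤s ()))

≗₃ : {x y : Vector ℕ 3} → x f0 ≡ y f0 → x f1 ≡ y f1 → x f2 ≡ y f2 → x ≗ y
≗₃ e₀ e₁ e₂ zero             = e₀
≗₃ e₀ e₁ e₂ (suc zero)       = e₁
≗₃ e₀ e₁ e₂ (suc (suc zero)) = e₂

pattern₃ : ∀ {lo mid hi} {x : Vector ℕ 3} (σ : Vector (Fin 3) 3) {_ : True (isInjective? σ)} →
           lo < mid → mid < hi → x ≗ (lo ∷ mid ∷ hi ∷ []) ∘ σ → HasPattern x σ
pattern₃ σ {σ-inj} lo<mid mid<hi x≗ =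
  HasPattern-resp-≗ (λ i → sym (x≗ i)) (HasPattern-sorted (increasing₃ lo<mid mid<hi) (toWitness σ-inj))

AscendingPattern : Vector ℕ 3 → Set
AscendingPattern x = HasPattern x (perm f0 f1 f2) ⊎ HasPattern x (perm f0 f2 f1) ⊎ HasPattern x (perm f1 f2 f0)

DescendingPattern : Vector ℕ 3 → Set
DescendingPattern x = HasPattern x (perm f1 f0 f2) ⊎ HasPattern x (perm f2 f0 f1) ⊎ HasPattern x (perm f2 f1 f0)

ascending-patterns : ∀ {a b c} → a < b → c ≢ a → c ≢ b → AscendingPattern (a ∷ b ∷ c ∷ [])
ascending-patterns {a} {b} {c} a<b c≢a c≢b with <-cmp c a
... | tri< c<a _ _ = inj₂ (inj₂ (pattern₃ (perm f1 f2 f0) c<a a<b (≗₃ refl refl refl)))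
... | tri≈ _ c≡a _ = contradiction c≡a c≢a
... | tri> _ _ a<c with <-cmp c b
...   | tri< c<b _ _ = inj₂ (inj₁ (pattern₃ (perm f0 f2 f1) a<c c<b (≗₃ refl refl refl)))
...   | tri≈ _ c≡b _ = contradiction c≡b c≢b
...   | tri> _ _ b<c = inj₁ (pattern₃ (perm f0 f1 f2) a<b b<c (≗₃ refl refl refl))

descending-patterns : ∀ {a b c} → b < a → c ≢ a → c ≢ b → DescendingPattern (a ∷ b ∷ c ∷ [])
descending-patterns {a} {b} {c} b<a c≢a c≢b with <-cmp c b
... | tri< c<b _ _ = inj₂ (inj₂ (pattern₃ (perm f2 f1 f0) c<b b<a (≗₃ refl refl refl)))
... | tri≈ _ c≡b _ = contradiction c≡b c≢b
... | tri> _ _ b<c with <-cmp c a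
...   | tri< c<a _ _ = inj₂ (inj₁ (pattern₃ (perm f2 f0 f1) b<c c<a (≗₃ refl refl refl)))
...   | tri≈ _ c≡a _ = contradiction c≡a c≢a
...   | tri> _ _ a<c = inj₁ (pattern₃ (perm f1 f0 f2) b<a a<c (≗₃ refl refl refl))

HasPattern-< : ∀ {n} {x : Vector ℕ n} {σ : Vector (Fin n) n} → HasPattern x σ → ∀ i j → σ i <ᶠ σ j → x i < x j
HasPattern-< (_ , ord) i j = proj₂ (ord i j)

AscendingPattern⇒< : ∀ {a b c} → AscendingPattern (a ∷ b ∷ c ∷ []) → a < b
AscendingPattern⇒< (inj₁ p)        = HasPattern-< p f0 f1 (s≤s z≤n)
AscendingPattern⇒< (inj₂ (inj₁ p)) = HasPattern-< p f0 f1 (s≤s z≤n)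
AscendingPattern⇒< (inj₂ (inj₂ p)) = HasPattern-< p f0 f1 (s≤s (s≤s z≤n))

DescendingPattern⇒< : ∀ {a b c} → DescendingPattern (a ∷ b ∷ c ∷ []) → b < a
DescendingPattern⇒< (inj₁ p)        = HasPattern-< p f1 f0 (s≤s z≤n)
DescendingPattern⇒< (inj₂ (inj₁ p)) = HasPattern-< p f1 f0 (s≤s z≤n)
DescendingPattern⇒< (inj₂ (inj₂ p)) = HasPattern-< p f1 f0 (s≤s (s≤s z≤n))

-- Counting

indicator : ∀ {A : Set} → Dec A → ℕ
indicator (yes _) = 1
indicator (no _)  = 0

countBelow : ∀ {P : Pred ℕ 0ℓ} → Decidable P → ℕ → ℕ
countBelow P? zero    = 0
countBelow P? (suc n) = countBelow P? n + indicator (P? n)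

module _ {P : Pred ℕ 0ℓ} (P? : Decidable P) where

  length-filter-[_] : ∀ x → length (filter P? [ x ]) ≡ indicator (P? x)
  length-filter-[_] x with P? x
  ... | yes _ = refl
  ... | no _  = refl

  length-filter-upTo : ∀ n → length (filter P? (upTo n)) ≡ countBelow P? n
  length-filter-upTo zero    = refl
  length-filter-upTo (suc n) = begin
    length (filter P? (upTo (suc n)))                        ≡⟨ cong (length ∘′ filter P?) (upTo-∷ʳ n) ⟨
    length (filter P? (upTo n ++ [ n ]))                     ≡⟨ cong length (filter-++ P? (upTo n) [ n ]) ⟩
    length (filter P? (upTo n) ++ filter P? [ n ])           ≡⟨ length-++ (filter P? (upTo n)) ⟩
    length (filter P? (upTo n)) + length (filter P? [ n ])
      ≡⟨ cong₂ _+_ (length-filter-upTo n) (length-filter-[ n ]) ⟩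
    countBelow P? n + indicator (P? n)                       ∎
    where open ≡-Reasoning

  countBelow-≤ : ∀ n → countBelow P? n ≤ n
  countBelow-≤ zero    = z≤n
  countBelow-≤ (suc n) with P? n
  ... | yes _ = ≤-trans (+-monoˡ-≤ 1 (countBelow-≤ n)) (≤-reflexive (+-comm n 1))
  ... | no _  = ≤-trans (≤-reflexive (+-identityʳ _)) (m≤n⇒m≤1+n (countBelow-≤ n))

  countBelow-mono-≤ : ∀ {m n} → m ≤ n → countBelow P? m ≤ countBelow P? n
  countBelow-mono-≤ {m} {n} m≤n = subst (λ k → countBelow P? m ≤ countBelow P? k) (m∸n+n≡m m≤n) (grow (n ∸ m))
    where
    grow : ∀ k → countBelow P? m ≤ countBelow P? (k + m)
    grow zero    = ≤-refl
    grow (suc k) = ≤-trans (grow k) (m≤m+n _ _)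

indicator-mono : ∀ {A B : Set} (a? : Dec A) (b? : Dec B) → (A → B) → indicator a? ≤ indicator b?
indicator-mono (yes a) (yes _) _   = ≤-refl
indicator-mono (yes a) (no ¬b) A→B = contradiction (A→B a) ¬b
indicator-mono (no _)  _       _   = z≤n

indicator-⊎ : ∀ {A B C : Set} (a? : Dec A) (b? : Dec B) (c? : Dec C) →
              (A → B ⊎ C) → indicator a? ≤ indicator b? + indicator c?
indicator-⊎ (no _)  _       _       _ = z≤n
indicator-⊎ (yes _) (yes _) _       _ = s≤s z≤n
indicator-⊎ (yes _) (no _)  (yes _) _ = s≤s z≤n
indicator-⊎ (yes a) (no ¬b) (no ¬c) A→B⊎C with A→B⊎C a
... | inj₁ b = contradiction b ¬b
... | inj₂ c = contradiction c ¬c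

countBelow-mono : ∀ {P Q : Pred ℕ 0ℓ} (P? : Decidable P) (Q? : Decidable Q) →
                  (∀ {m} → P m → Q m) → ∀ n → countBelow P? n ≤ countBelow Q? n
countBelow-mono P? Q? P⊆Q zero    = z≤n
countBelow-mono P? Q? P⊆Q (suc n) = +-mono-≤ (countBelow-mono P? Q? P⊆Q n) (indicator-mono (P? n) (Q? n) P⊆Q)

countBelow-cong : ∀ {P Q : Pred ℕ 0ℓ} (P? : Decidable P) (Q? : Decidable Q) →
                  (∀ {m} → P m → Q m) → (∀ {m} → Q m → P m) → ∀ n → countBelow P? n ≡ countBelow Q? n
countBelow-cong P? Q? P⊆Q Q⊆P n = ≤-antisym (countBelow-mono P? Q? P⊆Q n) (countBelow-mono Q? P? Q⊆P n)

countBelow-⊎ : ∀ {P Q R : Pred ℕ 0ℓ} (P? : Decidable P) (Q? : Decidable Q) (R? : Decidable R) →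
               (∀ {m} → P m → Q m ⊎ R m) → ∀ n → countBelow P? n ≤ countBelow Q? n + countBelow R? n
countBelow-⊎ P? Q? R? P⊆Q∪R zero    = z≤n
countBelow-⊎ P? Q? R? P⊆Q∪R (suc n) = begin
  countBelow P? n + indicator (P? n)
    ≤⟨ +-mono-≤ (countBelow-⊎ P? Q? R? P⊆Q∪R n) (indicator-⊎ (P? n) (Q? n) (R? n) P⊆Q∪R) ⟩
  (countBelow Q? n + countBelow R? n) + (indicator (Q? n) + indicator (R? n))
    ≡⟨ interchange (countBelow Q? n) (countBelow R? n) _ _ ⟩
  (countBelow Q? n + indicator (Q? n)) + (countBelow R? n + indicator (R? n))
    ∎
  where open ≤-Reasoning

∣4c-n∣≤3 : ∀ {c n} → c ≤ 1 → c ≤ n → n ≤ 3 → ∣ 4 * c - n ∣ ≤ 3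
∣4c-n∣≤3 {zero}        _        _ n≤3       = n≤3
∣4c-n∣≤3 {suc zero}    {suc n}  _ _ (s≤s n≤2) =
  ≤-trans (≤-reflexive (m≤n⇒∣n-m∣≡n∸m (m≤n⇒m≤1+n n≤2))) (m∸n≤m 3 n)
∣4c-n∣≤3 {suc (suc _)} (s≤s ())

residue? : ∀ r → Decidable (λ m → m % 4 ≡ r)
residue? r m = m % 4 ≟ r

module _ {r : ℕ} where

  residueWindow : ℕ → ℕ
  residueWindow n = indicator (residue? r n) + indicator (residue? r (1 + n))
           + indicator (residue? r (2 + n)) + indicator (residue? r (3 + n))

  residueWindow-suc : ∀ n → residueWindow (suc n) ≡ residueWindow n
  residueWindow-suc n = begin
    i 1 + i 2 + i 3 + indicator (residue? r (4 + n))
      ≡⟨ cong (λ x → i 1 + i 2 + i 3 + indicator (x ≟ r)) 4+n%4≡n%4 ⟩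
    i 1 + i 2 + i 3 + i 0                             ≡⟨ rotate (i 0) (i 1) (i 2) (i 3) ⟩
    i 0 + i 1 + i 2 + i 3                             ∎
    where
    open ≡-Reasoning
    i = λ k → indicator (residue? r (k + n))
    4+n%4≡n%4 : (4 + n) % 4 ≡ n % 4
    4+n%4≡n%4 = trans (cong (_% 4) (+-comm 4 n)) ([m+n]%n≡m%n n 4)
    rotate : ∀ a b c d → b + c + d + a ≡ a + b + c + d
    rotate = solve-∀

  residueWindow-0 : r < 4 → residueWindow 0 ≡ 1
  residueWindow-0 (s≤s z≤n)                   = refl
  residueWindow-0 (s≤s (s≤s z≤n))             = refl
  residueWindow-0 (s≤s (s≤s (s≤s z≤n)))       = refl
  residueWindow-0 (s≤s (s≤s (s≤s (s≤s z≤n)))) = refl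

  residueWindow≡1 : r < 4 → ∀ n → residueWindow n ≡ 1
  residueWindow≡1 r<4 zero    = residueWindow-0 r<4
  residueWindow≡1 r<4 (suc n) = trans (residueWindow-suc n) (residueWindow≡1 r<4 n)

  countBelow-residue-+4 : r < 4 → ∀ n → countBelow (residue? r) (4 + n) ≡ suc (countBelow (residue? r) n)
  countBelow-residue-+4 r<4 n = begin
    c + i 0 + i 1 + i 2 + i 3      ≡⟨ assoc c (i 0) (i 1) (i 2) (i 3) ⟩
    c + residueWindow n                   ≡⟨ cong (c +_) (residueWindow≡1 r<4 n) ⟩
    c + 1                          ≡⟨ +-comm c 1 ⟩
    suc c                          ∎
    where
    open ≡-Reasoning
    c = countBelow (residue? r) n
    i = λ k → indicator (residue? r (k + n))
    assoc : ∀ a b c d e → a + b + c + d + e ≡ a + (b + c + d + e)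
    assoc = solve-∀

  ∣4*countBelow-residue-n∣≤3-for-n≤3 : r < 4 → ∀ {n} → n ≤ 3 → ∣ 4 * countBelow (residue? r) n - n ∣ ≤ 3
  ∣4*countBelow-residue-n∣≤3-for-n≤3 r<4 {n} n≤3 = ∣4c-n∣≤3 c≤1 (countBelow-≤ (residue? r) n) n≤3
    where
    c≤1 : countBelow (residue? r) n ≤ 1
    c≤1 = ≤-trans (countBelow-mono-≤ (residue? r) (m≤n⇒m≤1+n n≤3)) (≤-reflexive (countBelow-residue-+4 r<4 0))

  ∣4*countBelow-residue-n∣≤3 : r < 4 → ∀ n → ∣ 4 * countBelow (residue? r) n - n ∣ ≤ 3
  ∣4*countBelow-residue-n∣≤3 r<4 (suc (suc (suc (suc n)))) = begin
    ∣ 4 * countBelow (residue? r) (4 + n) - 4 + n ∣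
                                                     ≡⟨ cong (λ c → ∣ 4 * c - 4 + n ∣) (countBelow-residue-+4 r<4 n) ⟩
    ∣ 4 * suc c - 4 + n ∣                            ≡⟨ cong (∣_- 4 + n ∣) (*-suc 4 c) ⟩
    ∣ 4 + 4 * c - 4 + n ∣                            ≡⟨ ∣m+n-m+o∣≡∣n-o∣ 4 (4 * c) n ⟩
    ∣ 4 * c - n ∣                                    ≤⟨ ∣4*countBelow-residue-n∣≤3 r<4 n ⟩
    3                                                ∎
    where
    open ≤-Reasoning
    c = countBelow (residue? r) n
  ∣4*countBelow-residue-n∣≤3 r<4 zero                   = z≤n
  ∣4*countBelow-residue-n∣≤3 r<4 (suc zero)             =
    ∣4*countBelow-residue-n∣≤3-for-n≤3 r<4 (s≤s z≤n)
  ∣4*countBelow-residue-n∣≤3 r<4 (suc (suc zero))       =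
    ∣4*countBelow-residue-n∣≤3-for-n≤3 r<4 (s≤s (s≤s z≤n))
  ∣4*countBelow-residue-n∣≤3 r<4 (suc (suc (suc zero))) =
    ∣4*countBelow-residue-n∣≤3-for-n≤3 r<4 (s≤s (s≤s (s≤s z≤n)))

-- Densities

∣⊖∣≡∣-∣ : ∀ m n → ℤ.∣ m ⊖ n ∣ ≡ ∣ m - n ∣
∣⊖∣≡∣-∣ m n with ≤-total m n
... | inj₁ m≤n = trans (ℤ.∣⊖∣-≤ m≤n) (sym (m≤n⇒∣m-n∣≡n∸m m≤n))
... | inj₂ n≤m = trans (ℤ.∣m⊖n∣≡∣n⊖m∣ m n) (trans (ℤ.∣⊖∣-≤ n≤m) (sym (m≤n⇒∣n-m∣≡n∸m n≤m)))

-- |a/(n+1) − ½| = |2a − (n+1)| / 2(n+1), which the hypothesis bounds by 1/(2(q+1)) < (p+1)/(q+1).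
∣a/n-½∣<ε : ∀ a n {p q} .{c : Coprime (suc p) (suc q)} → ∣ a * 2 - suc n ∣ * suc q ≤ suc n →
            ℚ.∣ (ℤ.+ a ÷ suc n) - ½ ∣ <ℚ mkℚ (ℤ.+ suc p) q c
∣a/n-½∣<ε a n {p} {q} err = ℚ.toℚᵘ-cancel-< (ℚᵘ.<-respˡ-≃ (ℚᵘ.≃-sym toℚᵘ-distance) distance<ε)
  where
  x = ℤ.+ a ÷ suc n
  u = mkℚᵘ (ℤ.+ a) n
  toℚᵘ-distance : toℚᵘ (ℚ.∣ x - ½ ∣) ℚᵘ.≃ ℚᵘ.∣ u ℚᵘ.+ mkℚᵘ -[1+ 0 ] 1 ∣
  toℚᵘ-distance = ℚᵘ.≃-trans (ℚ.toℚᵘ-homo-∣-∣ (x - ½))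
                    (ℚᵘ.∣-∣-cong (ℚᵘ.≃-trans (ℚ.toℚᵘ-homo-+ x (ℚ.- ½))
                      (ℚᵘ.+-congˡ (mkℚᵘ -[1+ 0 ] 1) (ℚ.toℚᵘ-fromℚᵘ u))))
  d = ∣ a * 2 - suc n ∣
  numerator : ℤ.∣ ℤ.+ a ℤ.* ℤ.+ 2 ℤ.+ -[1+ 0 ] ℤ.* ℤ.+ suc n ∣ ≡ d
  numerator = trans (cong ℤ.∣_∣ (trans (cong₂ ℤ._+_ (sym (ℤ.pos-* a 2)) (ℤ.-1*i≡-i (ℤ.+ suc n)))
                                       (ℤ.m-n≡m⊖n (a * 2) (suc n))))
                    (∣⊖∣≡∣-∣ (a * 2) (suc n))
  d*[1+q]<[1+p]*2[1+n] : d * suc q < suc p * (suc n * 2)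
  d*[1+q]<[1+p]*2[1+n] = ≤-<-trans err (<-≤-trans (m<m*n (suc n) 2 ≤-refl) (m≤n*m (suc n * 2) (suc p)))
  distance<ε : ℚᵘ.∣ u ℚᵘ.+ mkℚᵘ -[1+ 0 ] 1 ∣ ℚᵘ.< mkℚᵘ (ℤ.+ suc p) q
  distance<ε = ℚᵘ.*<* (subst₂ ℤ._<_ (trans (ℤ.pos-* d (suc q)) (cong (λ k → ℤ.+ k ℤ.* ℤ.+ suc q) (sym numerator)))
                                    (ℤ.pos-* (suc p) (suc n * 2)) (+<+ d*[1+q]<[1+p]*2[1+n]))

Negligible : (ℕ → ℕ) → Set
Negligible f = ∀ D → ∃ λ N → ∀ n → N ≤ n → D * f n ≤ n

const-negligible : ∀ c → Negligible (λ _ → c)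
const-negligible c D = D * c , λ _ N≤n → N≤n

j*j≤2^j : ∀ {j} → 4 ≤ j → j * j ≤ 2 ^ j
j*j≤2^j {j} 4≤j = subst (λ j → j * j ≤ 2 ^ j) (m+[n∸m]≡n 4≤j) (go (j ∸ 4))
  where
  go : ∀ i → (4 + i) * (4 + i) ≤ 2 ^ (4 + i)
  go zero    = ≤-refl
  go (suc i) = begin
    (5 + i) * (5 + i)                           ≤⟨ m≤m+n _ (7 + 6 * i + i * i) ⟩
    (5 + i) * (5 + i) + (7 + 6 * i + i * i)     ≡⟨ square-step i ⟨
    2 * ((4 + i) * (4 + i))                     ≤⟨ *-monoʳ-≤ 2 (go i) ⟩
    2 * 2 ^ (4 + i)                             ∎
    where
    open ≤-Reasoning
    square-step : ∀ i → 2 * ((4 + i) * (4 + i)) ≡ (5 + i) * (5 + i) + (7 + 6 * i + i * i)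
    square-step = solve-∀

2^-dominates-linear : ∀ a b → ∃ λ J → ∀ j → J ≤ j → a * j + b ≤ 2 ^ j
2^-dominates-linear a b = 4 + a + b , λ j J≤j → begin
  a * j + b        ≤⟨ +-monoʳ-≤ (a * j) (≤-trans (m≤n+m b (4 + a)) J≤j) ⟩
  a * j + j        ≡⟨ +-comm (a * j) j ⟩
  suc a * j        ≤⟨ *-monoˡ-≤ j (≤-trans (s≤s (m≤n+m a 3)) (≤-trans (m≤m+n (4 + a) b) J≤j)) ⟩
  j * j            ≤⟨ j*j≤2^j (≤-trans (m≤m+n 4 (a + b)) (≤-trans (≤-reflexive (sym (+-assoc 4 a b))) J≤j)) ⟩
  2 ^ j            ∎
  where open ≤-Reasoning

power-of-2-between : ∀ n → ∃ λ j → n ≤ 2 ^ j × 2 ^ j ≤ 2 * n + 1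
power-of-2-between zero = 0 , z≤n , ≤-refl
power-of-2-between (suc n) with power-of-2-between n
... | j , n≤2^j , 2^j≤2n+1 with suc n ≤? 2 ^ j
...   | yes n<2^j = j , n<2^j , ≤-trans 2^j≤2n+1 (+-monoˡ-≤ 1 (*-monoʳ-≤ 2 (n≤1+n n)))
...   | no  n≮2^j = suc j , +-mono-≤ (m^n>0 2 j) (≤-trans n≤2^j (m≤m+n (2 ^ j) 0)) , (begin
  2 * 2 ^ j        ≡⟨ cong (2 *_) 2^j≡n ⟩
  2 * n            ≤⟨ *-monoʳ-≤ 2 (n≤1+n n) ⟩
  2 * suc n        ≤⟨ m≤m+n (2 * suc n) 1 ⟩
  2 * suc n + 1    ∎)
  where
  open ≤-Reasoning
  2^j≡n : 2 ^ j ≡ n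
  2^j≡n = ≤-antisym (≤-pred (≰⇒> n≮2^j)) n≤2^j

log-negligible : ∀ {f : ℕ → ℕ} a b → (∀ n j → n ≤ 2 ^ j → f n ≤ a * j + b) → Negligible f
log-negligible {f} a b f≤log D with 2^-dominates-linear (2 * D * a) (2 * D * b + 1)
... | J , dominated = D * (a * J + b) , bound
  where
  bound : ∀ n → D * (a * J + b) ≤ n → D * f n ≤ n
  bound n N≤n with power-of-2-between n
  ... | j , n≤2^j , 2^j≤2n+1 = ≤-trans (*-monoʳ-≤ D (f≤log n j n≤2^j)) D*[aj+b]≤n
    where
    D*[aj+b]≤n : D * (a * j + b) ≤ n
    D*[aj+b]≤n with ≤-total j J
    ... | inj₁ j≤J = ≤-trans (*-monoʳ-≤ D (+-monoˡ-≤ b (*-monoʳ-≤ a j≤J))) N≤n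
    ... | inj₂ J≤j = *-cancelˡ-≤ 2 (+-cancelʳ-≤ 1 _ _ (begin
      2 * (D * (a * j + b)) + 1         ≡⟨ expand D a b j ⟩
      2 * D * a * j + (2 * D * b + 1)   ≤⟨ dominated j J≤j ⟩
      2 ^ j                             ≤⟨ 2^j≤2n+1 ⟩
      2 * n + 1                         ∎))
      where
      open ≤-Reasoning
      expand : ∀ D a b j → 2 * (D * (a * j + b)) + 1 ≡ 2 * D * a * j + (2 * D * b + 1)
      expand = solve-∀

½-density : ∀ {P : Pred ℕ 0ℓ} (P? : Decidable P) {E : ℕ → ℕ} → Negligible E →
            (∀ n → ∣ 4 * count P? n - n ∣ ≤ E n) → HasOddDensity P? ½
½-density P? {E} negligible err (mkℚ (ℤ.+ suc p) q _) _ with negligible (suc q)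
... | N , small = N , λ M N≤M → ∣a/n-½∣<ε (2 * count P? (suc M)) M (scaled-error M N≤M)
  where
  scaled-error : ∀ M → N ≤ M → ∣ 2 * count P? (suc M) * 2 - suc M ∣ * suc q ≤ suc M
  scaled-error M N≤M = begin
    ∣ 2 * c * 2 - suc M ∣ * suc q   ≡⟨ cong (λ x → ∣ x - suc M ∣ * suc q) (2*c*2≡4*c c) ⟩
    ∣ 4 * c - suc M ∣ * suc q       ≤⟨ *-monoˡ-≤ (suc q) (err (suc M)) ⟩
    E (suc M) * suc q               ≡⟨ *-comm (E (suc M)) (suc q) ⟩
    suc q * E (suc M)               ≤⟨ small (suc M) (m≤n⇒m≤1+n N≤M) ⟩
    suc M                           ∎
    where
    open ≤-Reasoning
    c = count P? (suc M)
    2*c*2≡4*c : ∀ c → 2 * c * 2 ≡ 4 * c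
    2*c*2≡4*c = solve-∀
½-density P? _ _ (mkℚ (ℤ.+ zero) _ _) (*<* (+<+ ()))
½-density P? _ _ (mkℚ -[1+ _ ] _ _) (*<* ())

-- The Syracuse function

n≡1+m+d⇒m<n : ∀ {m n} d → n ≡ suc (m + d) → m < n
n≡1+m+d⇒m<n {m} d refl = s≤s (m≤m+n m d)

oddPart′-odd : ∀ f {n} → Odd n → oddPart′ (suc f) n ≡ n
oddPart′-odd f {suc n} odd with suc n % 2 ≟ 0
... | yes even = contradiction (trans (sym even) odd) 0≢1+n
... | no _     = refl

oddPart′-*2 : ∀ f n → oddPart′ (suc f) (suc n * 2) ≡ oddPart′ f (suc n)
oddPart′-*2 f n with suc n * 2 % 2 ≟ 0
... | yes _   = cong (oddPart′ f) (m*n/n≡m (suc n) 2)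
... | no ¬even = contradiction (m*n%n≡0 (suc n) 2) ¬even

oddPart′-≤ : ∀ f n → oddPart′ f n ≤ n
oddPart′-≤ zero    n       = ≤-refl
oddPart′-≤ (suc f) zero    = z≤n
oddPart′-≤ (suc f) (suc n) with suc n % 2 ≟ 0
... | yes _ = ≤-trans (oddPart′-≤ f (suc n / 2)) (m/n≤m (suc n) 2)
... | no _  = ≤-refl

oddPart′-*2^ : ∀ f n → ∃ λ e → oddPart′ f n * 2 ^ e ≡ n
oddPart′-*2^ zero    n       = 0 , *-identityʳ n
oddPart′-*2^ (suc f) zero    = 0 , refl
oddPart′-*2^ (suc f) (suc n) with suc n % 2 ≟ 0
... | no _     = 0 , *-identityʳ (suc n)
... | yes even with oddPart′-*2^ f (suc n / 2)
...   | e , o*2^e≡half = suc e , (begin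
  o * (2 * 2 ^ e)   ≡⟨ cong (o *_) (*-comm 2 (2 ^ e)) ⟩
  o * (2 ^ e * 2)   ≡⟨ *-assoc o (2 ^ e) 2 ⟨
  o * 2 ^ e * 2     ≡⟨ cong (_* 2) o*2^e≡half ⟩
  suc n / 2 * 2     ≡⟨ m/n*n≡m (m%n≡0⇒n∣m (suc n) 2 even) ⟩
  suc n             ∎)
  where
  open ≡-Reasoning
  o = oddPart′ f (suc n / 2)

%2≢0⇒Odd : ∀ n → n % 2 ≢ 0 → Odd n
%2≢0⇒Odd n n%2≢0 with n % 2 | m%n<n n 2
... | 0           | _               = contradiction refl n%2≢0
... | 1           | _               = refl
... | suc (suc _) | s≤s (s≤s ())

Odd-oddPart′ : ∀ f n → 0 < n → n ≤ f → Odd (oddPart′ f n)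
Odd-oddPart′ (suc f) (suc zero)    _ _ = refl
Odd-oddPart′ (suc f) (suc (suc n)) _ (s≤s n<f) with suc (suc n) % 2 ≟ 0
... | yes _    = Odd-oddPart′ f (suc (suc n) / 2) (m≥n⇒m/n>0 {suc (suc n)} (s≤s (s≤s z≤n)))
                   (≤-trans (≤-pred (m/n<m (suc (suc n)) 2 ≤-refl)) n<f)
... | no ¬even = %2≢0⇒Odd (suc (suc n)) ¬even

S≡oddPart′ : ∀ m → S m ≡ oddPart′ (suc (3 * m)) (3 * m + 1)
S≡oddPart′ m = cong (λ f → oddPart′ f (3 * m + 1)) (+-comm (3 * m) 1)

S-odd : ∀ m → Odd (S m)
S-odd m = Odd-oddPart′ (3 * m + 1) (3 * m + 1) (m≤n+m 1 (3 * m)) ≤-refl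

S-*2^ : ∀ m → ∃ λ e → S m * 2 ^ e ≡ 3 * m + 1
S-*2^ m = oddPart′-*2^ (3 * m + 1) (3 * m + 1)

Odd-1+2k : ∀ k → Odd (1 + k * 2)
Odd-1+2k k = [m+kn]%n≡m%n 1 k 2

Odd-1+4k : ∀ k → Odd (1 + k * 4)
Odd-1+4k k = subst (λ n → Odd (1 + n)) (*-assoc k 2 2) (Odd-1+2k (k * 2))

Odd-3+4k : ∀ k → Odd (3 + k * 4)
Odd-3+4k k = subst (λ n → Odd (3 + n)) (*-assoc k 2 2) (Odd-1+2k (1 + k * 2))

Odd-5+6k : ∀ k → Odd (5 + k * 6)
Odd-5+6k k = subst (λ n → Odd (5 + n)) (*-assoc k 3 2) (Odd-1+2k (2 + k * 3))

S-3+4k : ∀ k → S (3 + k * 4) ≡ 5 + k * 6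
S-3+4k k = begin
  S m                                            ≡⟨ S≡oddPart′ m ⟩
  oddPart′ (suc (3 * m)) (3 * m + 1)             ≡⟨ cong (oddPart′ (suc (3 * m))) (3m+1≡ k) ⟩
  oddPart′ (suc (3 * m)) (suc (4 + k * 6) * 2)   ≡⟨ oddPart′-*2 (3 * m) (4 + k * 6) ⟩
  oddPart′ (3 * m) (5 + k * 6)                   ≡⟨ oddPart′-odd _ (Odd-5+6k k) ⟩
  5 + k * 6                                      ∎
  where
  open ≡-Reasoning
  m = 3 + k * 4
  3m+1≡ : ∀ k → 3 * (3 + k * 4) + 1 ≡ suc (4 + k * 6) * 2
  3m+1≡ = solve-∀

S-1+4k-≤ : ∀ k → S (1 + k * 4) ≤ 1 + k * 3
S-1+4k-≤ k = begin
  S m                                                  ≡⟨ S≡oddPart′ m ⟩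
  oddPart′ (suc (3 * m)) (3 * m + 1)                   ≡⟨ cong (oddPart′ (suc (3 * m))) (3m+1≡ k) ⟩
  oddPart′ (suc (3 * m)) (suc (1 + k * 3 * 2) * 2)     ≡⟨ oddPart′-*2 (3 * m) (1 + k * 3 * 2) ⟩
  oddPart′ (3 * m) (suc (k * 3) * 2)                   ≡⟨ oddPart′-*2 (pred (3 * m)) (k * 3) ⟩
  oddPart′ (pred (3 * m)) (1 + k * 3)                  ≤⟨ oddPart′-≤ (pred (3 * m)) (1 + k * 3) ⟩
  1 + k * 3                                            ∎
  where
  open ≤-Reasoning
  m = 1 + k * 4
  3m+1≡ : ∀ k → 3 * (1 + k * 4) + 1 ≡ suc (1 + k * 3 * 2) * 2
  3m+1≡ = solve-∀

Odd⇒>0 : ∀ {n} → Odd n → 0 < n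
Odd⇒>0 {suc n} _ = s≤s z≤n

x*2^e≡3x+1⇒x≡1 : ∀ {x} e → 0 < x → x * 2 ^ e ≡ 3 * x + 1 → x ≡ 1
x*2^e≡3x+1⇒x≡1 {x} e x>0 eq with e ≤? 1
... | yes e≤1 = contradiction eq (<⇒≢ (begin-strict
  x * 2 ^ e   ≤⟨ *-monoʳ-≤ x (^-monoʳ-≤ 2 e≤1) ⟩
  x * 2       ≤⟨ *-monoʳ-≤ x (s≤s (s≤s z≤n)) ⟩
  x * 3       ≡⟨ *-comm x 3 ⟩
  3 * x       <⟨ m<m+n (3 * x) (s≤s z≤n) ⟩
  3 * x + 1   ∎))
  where open ≤-Reasoning
... | no e≰1 = ≤-antisym (+-cancelˡ-≤ (3 * x) x 1 (begin
  3 * x + x   ≡⟨ +-comm (3 * x) x ⟩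
  4 * x       ≡⟨ *-comm 4 x ⟩
  x * 2 ^ 2   ≤⟨ *-monoʳ-≤ x (^-monoʳ-≤ 2 (≰⇒> e≰1)) ⟩
  x * 2 ^ e   ≡⟨ eq ⟩
  3 * x + 1   ∎)) x>0
  where open ≤-Reasoning

S[m]≡m⇒m≡1 : ∀ {m} → S m ≡ m → m ≡ 1
S[m]≡m⇒m≡1 {m} Sm≡m with S-*2^ m
... | e , Sm*2^e≡3m+1 =
  x*2^e≡3x+1⇒x≡1 e (subst (0 <_) Sm≡m (Odd⇒>0 (S-odd m))) (subst (λ x → x * 2 ^ e ≡ 3 * m + 1) Sm≡m Sm*2^e≡3m+1)

-- (3 + 4k)·2^e = 16 + 18k has no solution: 2^e would lie strictly between 4 and 8.
S-5+6k≢3+4k : ∀ k → S (5 + k * 6) ≢ 3 + k * 4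
S-5+6k≢3+4k k S≡ with S-*2^ (5 + k * 6)
... | e , S*2^e≡ with e ≤? 2 | subst (λ x → x * 2 ^ e ≡ 3 * (5 + k * 6) + 1) S≡ S*2^e≡
...   | yes e≤2 | eq = contradiction eq (<⇒≢ (begin-strict
  (3 + k * 4) * 2 ^ e      ≤⟨ *-monoʳ-≤ (3 + k * 4) (^-monoʳ-≤ 2 e≤2) ⟩
  (3 + k * 4) * 2 ^ 2      <⟨ n≡1+m+d⇒m<n (3 + k * 2) (below k) ⟩
  3 * (5 + k * 6) + 1      ∎))
  where
  open ≤-Reasoning
  below : ∀ k → 3 * (5 + k * 6) + 1 ≡ suc ((3 + k * 4) * 2 ^ 2 + (3 + k * 2))
  below = solve-∀
...   | no e≰2 | eq = contradiction (sym eq) (<⇒≢ (begin-strict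
  3 * (5 + k * 6) + 1      <⟨ n≡1+m+d⇒m<n (7 + k * 14) (above k) ⟩
  (3 + k * 4) * 2 ^ 3      ≤⟨ *-monoʳ-≤ (3 + k * 4) (^-monoʳ-≤ 2 (≰⇒> e≰2)) ⟩
  (3 + k * 4) * 2 ^ e      ∎))
  where
  open ≤-Reasoning
  above : ∀ k → (3 + k * 4) * 2 ^ 3 ≡ suc (3 * (5 + k * 6) + 1 + (7 + k * 14))
  above = solve-∀

S[m]≡1⇒2^e≡3m+1 : ∀ m → S m ≡ 1 → ∃ λ e → 2 ^ e ≡ 3 * m + 1
S[m]≡1⇒2^e≡3m+1 m Sm≡1 with S-*2^ m
... | e , eq = e , trans (sym (*-identityˡ (2 ^ e))) (subst (λ x → x * 2 ^ e ≡ 3 * m + 1) Sm≡1 eq)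

data OddResidue : ℕ → Set where
  1+4k : ∀ k → OddResidue (1 + k * 4)
  3+4k : ∀ k → OddResidue (3 + k * 4)

¬Odd-*2 : ∀ n → ¬ Odd (n * 2)
¬Odd-*2 n odd = contradiction (trans (sym (m*n%n≡0 n 2)) odd) 0≢1+n

oddResidue : ∀ m → Odd m → OddResidue m
oddResidue m odd with m % 4 | m≡m%n+[m/n]*n m 4 | m%n<n m 4
... | 0 | eq | _ = ⊥-elim (¬Odd-*2 (m / 4 * 2) (subst Odd (trans eq (sym (*-assoc (m / 4) 2 2))) odd))
... | 1 | eq | _ = subst OddResidue (sym eq) (1+4k (m / 4))
... | 2 | eq | _ =
  ⊥-elim (¬Odd-*2 (1 + m / 4 * 2) (subst Odd (trans eq (cong (2 +_) (sym (*-assoc (m / 4) 2 2)))) odd))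
... | 3 | eq | _ = subst OddResidue (sym eq) (3+4k (m / 4))
... | suc (suc (suc (suc _))) | _ | s≤s (s≤s (s≤s (s≤s ())))

S-ascends-3+4k : ∀ k → 3 + k * 4 < S (3 + k * 4)
S-ascends-3+4k k = subst (3 + k * 4 <_) (sym (S-3+4k k)) (n≡1+m+d⇒m<n (1 + k * 2) (diff k))
  where
  diff : ∀ k → 5 + k * 6 ≡ suc (3 + k * 4 + (1 + k * 2))
  diff = solve-∀

S-descends-1+4k : ∀ k → S (1 + suc k * 4) < 1 + suc k * 4
S-descends-1+4k k = ≤-<-trans (S-1+4k-≤ (suc k)) (+-monoʳ-< 1 (*-monoʳ-< (suc k) ≤-refl))

S-1+4k-¬ascends : ∀ k → ¬ (1 + k * 4 < S (1 + k * 4))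
S-1+4k-¬ascends k asc = <⇒≱ asc (≤-trans (S-1+4k-≤ k) (+-monoʳ-≤ 1 (*-monoʳ-≤ k (n≤1+n 3))))

m<S[m]⇒m%4≡3 : ∀ {m} → Odd m → m < S m → m % 4 ≡ 3
m<S[m]⇒m%4≡3 {m} odd asc with oddResidue m odd
... | 1+4k k = contradiction asc (S-1+4k-¬ascends k)
... | 3+4k k = [m+kn]%n≡m%n 3 k 4

S[m]<m⇒m%4≡1 : ∀ {m} → Odd m → S m < m → m % 4 ≡ 1
S[m]<m⇒m%4≡1 {m} odd desc with oddResidue m odd
... | 1+4k k = [m+kn]%n≡m%n 1 k 4
... | 3+4k k = contradiction desc (<⇒≯ (S-ascends-3+4k k))

m<S[m]⇒S[S[m]]≢m : ∀ {m} → Odd m → m < S m → S (S m) ≢ m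
m<S[m]⇒S[S[m]]≢m {m} odd asc with oddResidue m odd
... | 1+4k k = contradiction asc (S-1+4k-¬ascends k)
... | 3+4k k = S-5+6k≢3+4k k ∘ subst (λ n → S n ≡ 3 + k * 4) (S-3+4k k)

S[S[m]]≡m⇒m≡1 : ∀ {m} → Odd m → S (S m) ≡ m → m ≡ 1
S[S[m]]≡m⇒m≡1 {m} odd S²m≡m with <-cmp m (S m)
... | tri< asc _ _  = contradiction S²m≡m (m<S[m]⇒S[S[m]]≢m odd asc)
... | tri≈ _ m≡Sm _ = S[m]≡m⇒m≡1 (sym m≡Sm)
... | tri> _ _ desc =
  contradiction (cong S S²m≡m) (m<S[m]⇒S[S[m]]≢m (S-odd m) (subst (S m <_) (sym S²m≡m) desc))

orbit-distinct : ∀ {m} → Odd m → S m ≢ 1 → S (S m) ≢ m × S (S m) ≢ S m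
orbit-distinct odd Sm≢1 = (λ S²m≡m → Sm≢1 (cong S (S[S[m]]≡m⇒m≡1 odd S²m≡m))) , Sm≢1 ∘ S[m]≡m⇒m≡1

-- The sets A and B

%4≡r⇒≡r+[/4]*4 : ∀ {m r} → m % 4 ≡ r → m ≡ r + m / 4 * 4
%4≡r⇒≡r+[/4]*4 {m} m%4≡r = trans (m≡m%n+[m/n]*n m 4) (cong (_+ m / 4 * 4) m%4≡r)

InA⇒%4≡3 : ∀ {m} → InA m → m % 4 ≡ 3
InA⇒%4≡3 (odd , pat) = m<S[m]⇒m%4≡3 odd (AscendingPattern⇒< pat)

InB⇒%4≡1 : ∀ {m} → InB m → m % 4 ≡ 1
InB⇒%4≡1 (odd , pat) = S[m]<m⇒m%4≡1 odd (DescendingPattern⇒< pat)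

InA-3+4k : ∀ k → InA (3 + k * 4)
InA-3+4k k = Odd-3+4k k , uncurry (ascending-patterns asc) (orbit-distinct (Odd-3+4k k) Sm≢1)
  where
  asc = S-ascends-3+4k k
  Sm≢1 : S (3 + k * 4) ≢ 1
  Sm≢1 Sm≡1 with subst (3 + k * 4 <_) Sm≡1 asc
  ... | s≤s ()

InB-1+4k : ∀ k → S (1 + k * 4) ≢ 1 → InB (1 + k * 4)
InB-1+4k zero    S1≢1 = contradiction refl S1≢1
InB-1+4k (suc k) Sm≢1 =
  Odd-1+4k (suc k) , uncurry (descending-patterns (S-descends-1+4k k)) (orbit-distinct (Odd-1+4k (suc k)) Sm≢1)

%4≡3⇒InA : ∀ {m} → m % 4 ≡ 3 → InA m
%4≡3⇒InA {m} m%4≡3 = subst InA (sym (%4≡r⇒≡r+[/4]*4 m%4≡3)) (InA-3+4k (m / 4))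

%4≡1⇒InB⊎S≡1 : ∀ {m} → m % 4 ≡ 1 → InB m ⊎ S m ≡ 1
%4≡1⇒InB⊎S≡1 {m} m%4≡1 with S m ≟ 1
... | yes Sm≡1 = inj₂ Sm≡1
... | no Sm≢1  = inj₁ (subst InB (sym m≡) (InB-1+4k (m / 4) (Sm≢1 ∘ subst (λ n → S n ≡ 1) (sym m≡))))
  where m≡ = %4≡r⇒≡r+[/4]*4 m%4≡1

S≡1? : Decidable (λ m → S m ≡ 1)
S≡1? m = S m ≟ 1

-- Distinct m < n with S m = 1 have distinct exponents e with 2^e = 3m + 1 < 3n.
countBelow-S≡1-≤ : ∀ n j → 3 * n ≤ 2 ^ j → countBelow S≡1? n ≤ j
countBelow-S≡1-≤ zero    j _      = z≤n
countBelow-S≡1-≤ (suc n) j 3n≤2^j with S≡1? n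
... | no _ = ≤-trans (≤-reflexive (+-identityʳ _)) (countBelow-S≡1-≤ n j (≤-trans (*-monoʳ-≤ 3 (n≤1+n n)) 3n≤2^j))
... | yes Sn≡1 with S[m]≡1⇒2^e≡3m+1 n Sn≡1
...   | e , 2^e≡3n+1 = ≤-trans (≤-reflexive (+-comm (countBelow S≡1? n) 1)) (≤-<-trans count≤e e<j)
  where
  count≤e : countBelow S≡1? n ≤ e
  count≤e = countBelow-S≡1-≤ n e (≤-trans (m≤m+n (3 * n) 1) (≤-reflexive (sym 2^e≡3n+1)))
  e<j : e < j
  e<j = ≰⇒> λ j≤e → contradiction (begin-strict
    2 ^ j        ≤⟨ ^-monoʳ-≤ 2 j≤e ⟩
    2 ^ e        ≡⟨ 2^e≡3n+1 ⟩
    3 * n + 1    ≡⟨ +-comm (3 * n) 1 ⟩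
    1 + 3 * n    <⟨ +-monoˡ-< (3 * n) {1} {3} (s≤s (s≤s z≤n)) ⟩
    3 + 3 * n    ≡⟨ *-suc 3 n ⟨
    3 * suc n    ≤⟨ 3n≤2^j ⟩
    2 ^ j        ∎) (<-irrefl refl)
    where open ≤-Reasoning

∣x-n∣≤∣x-1+n∣+1 : ∀ x n → ∣ x - n ∣ ≤ ∣ x - suc n ∣ + 1
∣x-n∣≤∣x-1+n∣+1 x n = begin
  ∣ x - n ∣                          ≤⟨ ∣-∣-triangle x (suc n) n ⟩
  ∣ x - suc n ∣ + ∣ suc n - n ∣      ≡⟨ cong (∣ x - suc n ∣ +_) ∣1+n-n∣≡1 ⟩
  ∣ x - suc n ∣ + 1                  ∎
  where
  open ≤-Reasoning
  ∣1+n-n∣≡1 : ∣ suc n - n ∣ ≡ 1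
  ∣1+n-n∣≡1 = trans (m≤n⇒∣n-m∣≡n∸m (n≤1+n n)) (m+n∸n≡m 1 n)

∣4*countBelow-residue[1+n]-n∣≤4 : ∀ {r} → r < 4 → ∀ n → ∣ 4 * countBelow (residue? r) (suc n) - n ∣ ≤ 4
∣4*countBelow-residue[1+n]-n∣≤4 {r} r<4 n =
  ≤-trans (∣x-n∣≤∣x-1+n∣+1 (4 * countBelow (residue? r) (suc n)) n)
          (+-monoˡ-≤ 1 (∣4*countBelow-residue-n∣≤3 r<4 (suc n)))

∣4*count-InA-n∣≤4 : ∀ n → ∣ 4 * count InA? n - n ∣ ≤ 4
∣4*count-InA-n∣≤4 n = begin
  ∣ 4 * count InA? n - n ∣                         ≡⟨ cong (λ c → ∣ 4 * c - n ∣) count≡ ⟩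
  ∣ 4 * countBelow (residue? 3) (suc n) - n ∣      ≤⟨ ∣4*countBelow-residue[1+n]-n∣≤4 ≤-refl n ⟩
  4                                                ∎
  where
  open ≤-Reasoning
  count≡ : count InA? n ≡ countBelow (residue? 3) (suc n)
  count≡ = trans (length-filter-upTo InA? (suc n)) (countBelow-cong InA? (residue? 3) InA⇒%4≡3 %4≡3⇒InA (suc n))

∣4*count-InB-n∣≤4*countBelow-S≡1+4 : ∀ n → ∣ 4 * count InB? n - n ∣ ≤ 4 * countBelow S≡1? (suc n) + 4
∣4*count-InB-n∣≤4*countBelow-S≡1+4 n = begin
  ∣ 4 * count InB? n - n ∣             ≡⟨ cong (λ c → ∣ 4 * c - n ∣) (length-filter-upTo InB? (suc n)) ⟩
  ∣ 4 * b - n ∣                        ≤⟨ ∣-∣-triangle (4 * b) (4 * c) n ⟩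
  ∣ 4 * b - 4 * c ∣ + ∣ 4 * c - n ∣
                                       ≤⟨ +-mono-≤ ∣4b-4c∣≤4t (∣4*countBelow-residue[1+n]-n∣≤4 (s≤s (s≤s z≤n)) n) ⟩
  4 * t + 4                            ∎
  where
  open ≤-Reasoning
  b = countBelow InB? (suc n)
  c = countBelow (residue? 1) (suc n)
  t = countBelow S≡1? (suc n)
  b≤c : b ≤ c
  b≤c = countBelow-mono InB? (residue? 1) InB⇒%4≡1 (suc n)
  c≤b+t : c ≤ b + t
  c≤b+t = countBelow-⊎ (residue? 1) InB? S≡1? %4≡1⇒InB⊎S≡1 (suc n)
  ∣4b-4c∣≤4t : ∣ 4 * b - 4 * c ∣ ≤ 4 * t
  ∣4b-4c∣≤4t = begin
    ∣ 4 * b - 4 * c ∣   ≡⟨ *-distribˡ-∣-∣ 4 b c ⟨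
    4 * ∣ b - c ∣       ≡⟨ cong (4 *_) (m≤n⇒∣m-n∣≡n∸m b≤c) ⟩
    4 * (c ∸ b)         ≤⟨ *-monoʳ-≤ 4 (m≤n+o⇒m∸n≤o c b c≤b+t) ⟩
    4 * t               ∎

4*countBelow-S≡1+4≤4j+16 : ∀ n j → n ≤ 2 ^ j → 4 * countBelow S≡1? (suc n) + 4 ≤ 4 * j + 16
4*countBelow-S≡1+4≤4j+16 n j n≤2^j = begin
  4 * countBelow S≡1? (suc n) + 4
                                    ≤⟨ +-monoˡ-≤ 4 (*-monoʳ-≤ 4 (countBelow-S≡1-≤ (suc n) (3 + j) 3[1+n]≤2^[3+j])) ⟩
  4 * (3 + j) + 4                   ≡⟨ linear j ⟩
  4 * j + 16                        ∎
  where
  open ≤-Reasoning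
  linear : ∀ j → 4 * (3 + j) + 4 ≡ 4 * j + 16
  linear = solve-∀
  3[1+n]≤2^[3+j] : 3 * suc n ≤ 2 ^ (3 + j)
  3[1+n]≤2^[3+j] = begin
    3 * suc n            ≤⟨ *-monoʳ-≤ 3 (+-mono-≤ (m^n>0 2 j) (≤-trans n≤2^j (m≤m+n (2 ^ j) 0))) ⟩
    3 * 2 ^ (1 + j)      ≤⟨ *-monoˡ-≤ (2 ^ (1 + j)) (n≤1+n 3) ⟩
    4 * 2 ^ (1 + j)      ≡⟨ *-assoc 2 2 (2 ^ (1 + j)) ⟩
    2 ^ (3 + j)          ∎

mainTheorem3 : HasOddDensity InA? ½ × HasOddDensity InB? ½
mainTheorem3 =
    ½-density InA? (const-negligible 4) ∣4*count-InA-n∣≤4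
  , ½-density InB? (log-negligible 4 16 4*countBelow-S≡1+4≤4j+16) ∣4*count-InB-n∣≤4*countBelow-S≡1+4
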